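{- Let $T$ be a tree containing a vertex $v$ with neighbors $u$, $w$, and $v_1,\dots,v_t$ ($t\ge1$), all distinct, such that $v$ has no other neighbors. Let $P$ be the component of $T-v$ containing $u$, $Q$ the component of $T-v$ containing $w$, and $M$ the union of the components of $T-v$ containing $v_1,\dots,v_t$ (so $V(T)=\{v\}\cup V(P)\cup V(Q)\cup V(M)$, disjointly). Let $$T_u = T-\{vv_1,\dots,vv_t\}+\{uv_1,\dots,uv_t\},\qquad T_w = T-\{vv_1,\dots,vv_t\}+\{wv_1,\dots,wv_t\}.$$ Then $W(T) < \max\{W(T_u),W(T_w)\}$.
   Context: For a connected graph $H$, the Wiener index is $W(H)=\sum_{\{x,y\}\subset V(H)} d_H(x,y)$, where $d_H$ is the distance in $H$. For a graph $H$, $H-v$ is obtained by deleting vertex $v$ and its incident edges; $H-S$ ($H+S$) denotes deletion (addition) of the edge set $S$. -}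

module Defs where

open import Data.Bool using (Bool; true; false; _∧_; _∨_; if_then_else_; not)
open import Data.Nat using (ℕ; zero; suc; _≤_; _<ᵇ_)
open import Data.Fin using (Fin; toℕ; _≟_)
open import Data.List using (List; []; _∷_; _++_; [_]; length; map)
open import Data.Nat.ListAction using (sum)
open import Data.Bool.ListAction using (any)
open import Data.List.Relation.Unary.Unique.Propositional using (Unique)
import Data.List.Membership.DecPropositional as DecMem
open import Data.Fin using ()
open import Data.Product using (_×_)
open import Data.Unit using (⊤)
open import Data.Empty using (⊥)
open import Relation.Nullary using (¬_; does)
open import Relation.Binary.PropositionalEquality using (_≡_)
open import Data.List using (allFin)

Graph : ℕ → Set
Graph n = Fin n → Fin n → Bool

record IsSimple {n : ℕ} (G : Graph n) : Set where
  field
    sym     : ∀ x y → G x y ≡ G y x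
    irrefl  : ∀ x → G x x ≡ false

data Walk {n : ℕ} (G : Graph n) : Fin n → Fin n → Set where
  nil  : ∀ {x} → Walk G x x
  cons : ∀ {x y z} → G x y ≡ true → Walk G y z → Walk G x z

Connected : {n : ℕ} → Graph n → Set
Connected {n} G = (x y : Fin n) → Walk G x y

ConsecAdj : {n : ℕ} → Graph n → List (Fin n) → Set
ConsecAdj G []            = ⊤
ConsecAdj G (x ∷ [])      = ⊤
ConsecAdj G (x ∷ y ∷ xs)  = G x y ≡ true × ConsecAdj G (y ∷ xs)

IsCycle : {n : ℕ} → Graph n → List (Fin n) → Set
IsCycle G []       = ⊥
IsCycle G (x ∷ xs) = 3 ≤ length (x ∷ xs) × Unique (x ∷ xs) × ConsecAdj G ((x ∷ xs) ++ [ x ])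

Acyclic : {n : ℕ} → Graph n → Set
Acyclic {n} G = (xs : List (Fin n)) → ¬ IsCycle G xs

IsTree : {n : ℕ} → Graph n → Set
IsTree G = IsSimple G × Connected G × Acyclic G

-- reach G k x y = true iff there is a walk of length ≤ k from x to y.
reach : {n : ℕ} → Graph n → ℕ → Fin n → Fin n → Bool
reach G zero    x y = does (x ≟ y)
reach G (suc k) x y = reach G k x y ∨ any (λ z → reach G k x z ∧ G z y) (allFin _)

minSteps : {n : ℕ} → Graph n → Fin n → Fin n → ℕ → ℕ → ℕ
minSteps G x y k zero     = k
minSteps G x y k (suc f)  = if reach G k x y then k else minSteps G x y (suc k) f

-- Distance d_G(x,y): least k with a walk of length k (correct for connected graphs on n vertices,
-- where every distance is < n).
dist : {n : ℕ} → Graph n → Fin n → Fin n → ℕ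
dist {n} G x y = minSteps G x y 0 n

W : {n : ℕ} → Graph n → ℕ
W {n} G = sum (map (λ x → sum (map (λ y → if toℕ x <ᵇ toℕ y then dist G x y else 0) (allFin n))) (allFin n))

-- G - {v x : x ∈ vs} + {a x : x ∈ vs}
moveTo : {n : ℕ} → Graph n → (v a : Fin n) → List (Fin n) → Graph n
moveTo {n} G v a vs x y =
  if (does (x ≟ v) ∧ inVs y) ∨ (does (y ≟ v) ∧ inVs x) then false
  else if (does (x ≟ a) ∧ inVs y) ∨ (does (y ≟ a) ∧ inVs x) then true
  else G x y
  where
  inVs : Fin n → Bool
  inVs z = does (DecMem._∈?_ (_≟_ {n}) z vs)

-- Moving M from v
-- to u shortens every M–P distance by one, lengthens every distance from M to Q ∪ {v}
-- by one and leaves the others unchanged; moving M to w does the same with P and Q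
-- exchanged.  Hence d_{T_u} + d_{T_w} ≥ 2 d_T on every pair, with excess 2 between v and
-- M, so W(T_u) + W(T_w) > 2 W(T).  Only these lower bounds are proved: for fixed x the
-- potential z ↦ d_T(x, z) + shift (part x) (part z) changes by at most one along every
-- edge of T_u, so it bounds d_{T_u}(x, ·) from below.

module Submission where

open import Data.Bool using (Bool; true; false; if_then_else_)
open import Data.Bool.Properties using (T-≡; T-∨; T-∧)
open import Data.Empty using (⊥; ⊥-elim)
open import Data.Fin as Fin using (Fin; _≟_; toℕ)
open import Data.Fin.Properties using (pigeonhole; toℕ-injective)
open import Data.List using (List; []; _∷_; [_]; _∷ʳ_; length; map; allFin; lookup)
open import Data.List.Properties using (map-cong)
open import Data.List.Membership.Propositional using (_∈_; _∉_)
open import Data.List.Membership.Propositional.Properties using (∈-allFin; ∈-lookup)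
import Data.List.Membership.DecPropositional as DecMembership
open import Data.List.Relation.Unary.All as All using (All; []; _∷_)
open import Data.List.Relation.Unary.All.Properties using (¬Any⇒All¬; ∷ʳ⁺)
open import Data.List.Relation.Unary.AllPairs using ([]; _∷_)
open import Data.List.Relation.Unary.Any as Any using (here; there)
open import Data.List.Relation.Unary.Any.Properties using (any⁺; any⁻)
open import Data.List.Relation.Unary.Unique.Propositional using (Unique)
open import Data.List.Relation.Unary.Unique.Propositional.Properties using (++⁺)
open import Data.Nat using (ℕ; zero; suc; _+_; _≤_; _<_; _⊔_; z≤n; s≤s; _<ᵇ_)
open import Data.Nat.ListAction using (sum)
open import Data.Nat.Properties hiding (_≟_)
open import Algebra.Properties.CommutativeSemigroup +-commutativeSemigroup using (interchange)
open import Data.Product using (_×_; _,_; ∃-syntax; proj₁; proj₂)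
open import Data.Sum as Sum using (_⊎_; inj₁; inj₂; assocʳ; assocˡ)
open import Data.Unit using (tt)
open import Function.Base using (_∘_)
open import Function.Bundles using (_⇔_; Equivalence; mk⇔)
open import Relation.Binary.Definitions using (tri<; tri≈; tri>)
open import Relation.Binary.PropositionalEquality
  using (_≡_; _≢_; refl; sym; trans; cong; subst; subst₂; ≢-sym)
open import Relation.Nullary using (¬_; Dec; yes; no; does; contradiction)
open import Relation.Nullary.Decidable using (dec-true; dec-false; does-⇔; _×-dec_; _⊎-dec_)

open import Defs

private
  variable
    n : ℕ

Unique⇒lookup-≢ : {A : Set} {xs : List A} → Unique xs →
                  ∀ {i j} → i Fin.< j → lookup xs i ≢ lookup xs j
Unique⇒lookup-≢ (x∉xs ∷ _) {Fin.zero} {Fin.suc j} _ = All.lookup x∉xs (∈-lookup j)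
Unique⇒lookup-≢ (_ ∷ xs!) {Fin.suc i} {Fin.suc j} (s≤s i<j) = Unique⇒lookup-≢ xs! i<j

Unique⇒length≤ : {xs : List (Fin n)} → Unique xs → length xs ≤ n
Unique⇒length≤ {n} {xs} xs! with length xs ≤? n
... | yes xs≤n = xs≤n
... | no xs≰n with i , j , i<j , xsᵢ≡xsⱼ ← pigeonhole (≰⇒> xs≰n) (lookup xs) =
  contradiction xsᵢ≡xsⱼ (Unique⇒lookup-≢ xs! i<j)

Unique-∷ʳ : {A : Set} {xs : List A} {x : A} → Unique xs → All (_≢ x) xs → Unique (xs ∷ʳ x)
Unique-∷ʳ xs! xs≢x =
  ++⁺ xs! ([] ∷ []) λ { (y∈xs , here refl) → All.lookup xs≢x y∈xs refl }

sum-map-+ : {A : Set} (f g : A → ℕ) (xs : List A) →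
            sum (map (λ x → f x + g x) xs) ≡ sum (map f xs) + sum (map g xs)
sum-map-+ f g []       = refl
sum-map-+ f g (x ∷ xs) = trans (cong (f x + g x +_) (sum-map-+ f g xs))
                               (interchange (f x) (g x) (sum (map f xs)) (sum (map g xs)))

sum-map-mono-≤ : {A : Set} {f g : A → ℕ} → (∀ x → f x ≤ g x) →
                 ∀ xs → sum (map f xs) ≤ sum (map g xs)
sum-map-mono-≤ f≤g []       = z≤n
sum-map-mono-≤ f≤g (x ∷ xs) = +-mono-≤ (f≤g x) (sum-map-mono-≤ f≤g xs)

sum-map-mono-< : {A : Set} {f g : A → ℕ} → (∀ x → f x ≤ g x) →
                 ∀ {x xs} → x ∈ xs → f x < g x → sum (map f xs) < sum (map g xs)
sum-map-mono-< f≤g {xs = _ ∷ xs} (here refl)  fx<gx =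
  +-mono-<-≤ fx<gx (sum-map-mono-≤ f≤g xs)
sum-map-mono-< f≤g {xs = y ∷ _}  (there x∈xs) fx<gx =
  +-mono-≤-< (f≤g y) (sum-map-mono-< f≤g x∈xs fx<gx)

+-cancel-slack : ∀ s {a b m k} → a + m ≤ k + b → s + b ≤ a → s + m ≤ k
+-cancel-slack s {a} {b} {m} {k} a+m≤k+b s+b≤a = +-cancelˡ-≤ b (s + m) k (begin
  b + (s + m)  ≡⟨ sym (+-assoc b s m) ⟩
  b + s + m    ≡⟨ cong (_+ m) (+-comm b s) ⟩
  s + b + m    ≤⟨ +-monoˡ-≤ m s+b≤a ⟩
  a + m        ≤⟨ a+m≤k+b ⟩
  k + b        ≡⟨ +-comm k b ⟩
  b + k        ∎)
  where open ≤-Reasoning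

m+m<n+o⇒m<n⊔o : ∀ {m n o} → m + m < n + o → m < n ⊔ o
m+m<n+o⇒m<n⊔o {m} {n} {o} m+m<n+o = ≰⇒> λ n⊔o≤m →
  <⇒≱ m+m<n+o (+-mono-≤ (≤-trans (m≤m⊔n n o) n⊔o≤m) (≤-trans (m≤n⊔m n o) n⊔o≤m))

module _ {n : ℕ} (G : Graph n) where

  open Equivalence using (to; from)
  open DecMembership (_≟_ {n}) using (_∈?_)

  walkLength : ∀ {x y} → Walk G x y → ℕ
  walkLength nil        = 0
  walkLength (cons _ w) = suc (walkLength w)

  vertices : ∀ {x y} → Walk G x y → List (Fin n)
  vertices {x} nil        = x ∷ []
  vertices {x} (cons _ w) = x ∷ vertices w

  length-vertices : ∀ {x y} (w : Walk G x y) → length (vertices w) ≡ suc (walkLength w)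
  length-vertices nil        = refl
  length-vertices (cons _ w) = cong suc (length-vertices w)

  suffixFrom : ∀ {x y z} (w : Walk G x y) → z ∈ vertices w → Walk G z y
  suffixFrom nil        (here refl) = nil
  suffixFrom (cons e w) (here refl) = cons e w
  suffixFrom (cons _ w) (there z∈w) = suffixFrom w z∈w

  suffixFrom-unique : ∀ {x y z} (w : Walk G x y) (z∈w : z ∈ vertices w) →
                      Unique (vertices w) → Unique (vertices (suffixFrom w z∈w))
  suffixFrom-unique nil        (here refl) w!       = w!
  suffixFrom-unique (cons _ _) (here refl) w!       = w!
  suffixFrom-unique (cons _ w) (there z∈w) (_ ∷ w!) = suffixFrom-unique w z∈w w!

  prune : ∀ {x y} → Walk G x y → Walk G x y
  prune nil = nil
  prune {x} (cons e w) with x ∈? vertices (prune w)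
  ... | yes x∈w = suffixFrom (prune w) x∈w
  ... | no  _   = cons e (prune w)

  prune-unique : ∀ {x y} (w : Walk G x y) → Unique (vertices (prune w))
  prune-unique nil = [] ∷ []
  prune-unique {x} (cons e w) with x ∈? vertices (prune w)
  ... | yes x∈w = suffixFrom-unique (prune w) x∈w (prune-unique w)
  ... | no  x∉w = ¬Any⇒All¬ _ x∉w ∷ prune-unique w

  walkLength-prune-< : ∀ {x y} (w : Walk G x y) → walkLength (prune w) < n
  walkLength-prune-< w =
    subst (_≤ n) (length-vertices (prune w)) (Unique⇒length≤ (prune-unique w))

  reach-refl : ∀ x → reach G 0 x x ≡ true
  reach-refl x = dec-true (x ≟ x) refl

  reach-0⇒≡ : ∀ {x y} → reach G 0 x y ≡ true → x ≡ y
  reach-0⇒≡ {x} {y} r with x ≟ y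
  ... | yes x≡y = x≡y

  reach-suc : ∀ k {x y} → reach G k x y ≡ true → reach G (suc k) x y ≡ true
  reach-suc k r rewrite r = refl

  reach-step : ∀ k {x a b} → reach G k x a ≡ true → G a b ≡ true →
               reach G (suc k) x b ≡ true
  reach-step k {x} {a} {b} r e = to T-≡ (from T-∨ (inj₂ (any⁺ _ (Any.map
    (λ { refl → from (T-∧ {reach G k x a} {G a b}) (from T-≡ r , from T-≡ e) }) (∈-allFin a)))))

  reach-suc⁻ : ∀ k {x y} → reach G (suc k) x y ≡ true →
               reach G k x y ≡ true ⊎ ∃[ z ] reach G k x z ≡ true × G z y ≡ true
  reach-suc⁻ k r with to T-∨ (from T-≡ r)
  ... | inj₁ r′ = inj₁ (to T-≡ r′)
  ... | inj₂ r′ with z , rz∧e ← Any.satisfied (any⁻ _ (allFin n) r′)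
                 with rz , e ← to T-∧ rz∧e = inj₂ (z , to T-≡ rz , to T-≡ e)

  reach-cons : ∀ k {x y z} → G x y ≡ true → reach G k y z ≡ true →
               reach G (suc k) x z ≡ true
  reach-cons zero {x} {y} {z} e r with refl ← reach-0⇒≡ {y} {z} r =
    reach-step 0 {x} (reach-refl x) e
  reach-cons (suc k) {x} e r with reach-suc⁻ k r
  ... | inj₁ r′            = reach-suc (suc k) (reach-cons k e r′)
  ... | inj₂ (_ , r′ , e′) = reach-step (suc k) {x} (reach-cons k e r′) e′

  reach-walk : ∀ {x y} (w : Walk G x y) → reach G (walkLength w) x y ≡ true
  reach-walk {x} nil    = reach-refl x
  reach-walk (cons e w) = reach-cons (walkLength w) e (reach-walk w)

  reach-sym : (∀ a b → G a b ≡ G b a) →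
              ∀ k {x y} → reach G k x y ≡ true → reach G k y x ≡ true
  reach-sym G-sym zero {x} {y} r with refl ← reach-0⇒≡ {x} {y} r = r
  reach-sym G-sym (suc k) {y = y} r with reach-suc⁻ k r
  ... | inj₁ r′           = reach-suc k (reach-sym G-sym k r′)
  ... | inj₂ (z , r′ , e) = reach-cons k (trans (G-sym y z) e) (reach-sym G-sym k r′)

  reach-potential : (ψ : Fin n → ℕ) → (∀ {a b} → G a b ≡ true → ψ b ≤ suc (ψ a)) →
                    ∀ k {x y} → reach G k x y ≡ true → ψ y ≤ k + ψ x
  reach-potential ψ ψ-lip zero {x} {y} r with refl ← reach-0⇒≡ {x} {y} r = ≤-refl
  reach-potential ψ ψ-lip (suc k) r with reach-suc⁻ k r
  ... | inj₁ r′           = m≤n⇒m≤1+n (reach-potential ψ ψ-lip k r′)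
  ... | inj₂ (_ , r′ , e) = ≤-trans (ψ-lip e) (s≤s (reach-potential ψ ψ-lip k r′))

  minSteps-least : ∀ {x y} f {k j} → k ≤ j → reach G j x y ≡ true → minSteps G x y k f ≤ j
  minSteps-least zero k≤j _ = k≤j
  minSteps-least {x} {y} (suc f) {k} k≤j r with reach G k x y in eq
  ... | true  = k≤j
  ... | false = minSteps-least f (≤∧≢⇒< k≤j λ { refl → contradiction (trans (sym eq) r) λ () }) r

  minSteps-reaches : ∀ {x y} f k →
                     reach G (minSteps G x y k f) x y ≡ true ⊎ minSteps G x y k f ≡ k + f
  minSteps-reaches zero k = inj₂ (sym (+-identityʳ k))
  minSteps-reaches {x} {y} (suc f) k with reach G k x y in eq
  ... | true  = inj₁ eq
  ... | false with minSteps-reaches f (suc k)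
  ...   | inj₁ r  = inj₁ r
  ...   | inj₂ eq′ = inj₂ (trans eq′ (sym (+-suc k f)))

  dist-≤ : ∀ k {x y} → reach G k x y ≡ true → dist G x y ≤ k
  dist-≤ k = minSteps-least n z≤n

  -- dist G x y defaults to n when y is unreachable, hence the hypothesis ψ y ≤ n + ψ x.
  dist-potential : (ψ : Fin n → ℕ) → (∀ {a b} → G a b ≡ true → ψ b ≤ suc (ψ a)) →
                   ∀ x y → ψ y ≤ n + ψ x → ψ y ≤ dist G x y + ψ x
  dist-potential ψ ψ-lip x y ψy≤n+ψx with minSteps-reaches {x} {y} n 0
  ... | inj₁ r  = reach-potential ψ ψ-lip _ r
  ... | inj₂ eq = subst (λ m → ψ y ≤ m + ψ x) (sym eq) ψy≤n+ψx

  module _ (connected : Connected G) where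

    dist-< : ∀ x y → dist G x y < n
    dist-< x y = ≤-<-trans (dist-≤ _ (reach-walk (prune w))) (walkLength-prune-< w)
      where w = connected x y

    dist-reached : ∀ x y → reach G (dist G x y) x y ≡ true
    dist-reached x y with minSteps-reaches {x} {y} n 0
    ... | inj₁ r  = r
    ... | inj₂ eq = contradiction eq (<⇒≢ (dist-< x y))

nested-if≡true⇒ : {P Q : Set} (p : Dec P) (q : Dec Q) {b : Bool} →
                  (if does p then false else if does q then true else b) ≡ true → ¬ P × (Q ⊎ b ≡ true)
nested-if≡true⇒ (yes _)  _       ()
nested-if≡true⇒ (no ¬p) (yes q) _  = ¬p , inj₁ q
nested-if≡true⇒ (no ¬p) (no _)  eq = ¬p , inj₂ eq

moveTo-edge : ∀ {n} (G : Graph n) (v a : Fin n) (vs : List (Fin n)) {x y} →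
              moveTo G v a vs x y ≡ true →
              ¬ (x ≡ v × y ∈ vs ⊎ y ≡ v × x ∈ vs) ×
              ((x ≡ a × y ∈ vs ⊎ y ≡ a × x ∈ vs) ⊎ G x y ≡ true)
moveTo-edge G v a vs {x} {y} = nested-if≡true⇒
  ((x ≟ v ×-dec y ∈? vs) ⊎-dec (y ≟ v ×-dec x ∈? vs))
  ((x ≟ a ×-dec y ∈? vs) ⊎-dec (y ≟ a ×-dec x ∈? vs))
  where open DecMembership _≟_ using (_∈?_)

above : (Fin n → Fin n → ℕ) → Fin n → Fin n → ℕ
above f x y = if toℕ x <ᵇ toℕ y then f x y else 0

rowSum : (Fin n → Fin n → ℕ) → Fin n → ℕ
rowSum {n} f x = sum (map (above f x) (allFin n))

-- W G is definitionally pairSum (dist G).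
pairSum : (Fin n → Fin n → ℕ) → ℕ
pairSum {n} f = sum (map (rowSum f) (allFin n))

above-+ : (f g : Fin n → Fin n → ℕ) →
          ∀ x y → above (λ x y → f x y + g x y) x y ≡ above f x y + above g x y
above-+ f g x y with toℕ x <ᵇ toℕ y
... | true  = refl
... | false = refl

above-mono-≤ : {f g : Fin n → Fin n → ℕ} → (∀ x y → f x y ≤ g x y) →
               ∀ x y → above f x y ≤ above g x y
above-mono-≤ f≤g x y with toℕ x <ᵇ toℕ y
... | true  = f≤g x y
... | false = z≤n

above-mono-< : {f g : Fin n → Fin n → ℕ} → ∀ {x y} → toℕ x < toℕ y →
               f x y < g x y → above f x y < above g x y
above-mono-< {x = x} {y} x<y fxy<gxy rewrite Equivalence.to T-≡ (<⇒<ᵇ x<y) = fxy<gxy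

pairSum-+ : (f g : Fin n → Fin n → ℕ) → pairSum (λ x y → f x y + g x y) ≡ pairSum f + pairSum g
pairSum-+ {n} f g =
  trans (cong sum (map-cong rowSum-+ (allFin n))) (sum-map-+ (rowSum f) (rowSum g) (allFin n))
  where
  rowSum-+ : ∀ x → rowSum (λ x y → f x y + g x y) x ≡ rowSum f x + rowSum g x
  rowSum-+ x = trans (cong sum (map-cong (above-+ f g x) (allFin n)))
                     (sum-map-+ (above f x) (above g x) (allFin n))

pairSum-mono-< : {f g : Fin n → Fin n → ℕ} → (∀ x y → f x y ≤ g x y) →
                 ∀ {x y} → toℕ x < toℕ y → f x y < g x y → pairSum f < pairSum g
pairSum-mono-< {n} {f} {g} f≤g {x} {y} x<y fxy<gxy =
  sum-map-mono-< (λ x → sum-map-mono-≤ (above-mono-≤ f≤g x) (allFin n)) (∈-allFin x)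
    (sum-map-mono-< (above-mono-≤ f≤g x) (∈-allFin y) (above-mono-< {f = f} {g} x<y fxy<gxy))

pairSum-mono-<-pair : {f g : Fin n → Fin n → ℕ} → (∀ x y → f x y ≤ g x y) →
                      ∀ {x y} → x ≢ y → f x y < g x y → f y x < g y x → pairSum f < pairSum g
pairSum-mono-<-pair f≤g {x} {y} x≢y fxy<gxy fyx<gyx with <-cmp (toℕ x) (toℕ y)
... | tri< x<y _ _ = pairSum-mono-< f≤g x<y fxy<gxy
... | tri≈ _ x≡y _ = contradiction (toℕ-injective x≡y) x≢y
... | tri> _ _ y<x = pairSum-mono-< f≤g y<x fyx<gyx

module TreeDistance {n : ℕ} (T : Graph n) (tree : IsTree T) where

  open IsSimple (proj₁ tree) renaming (sym to T-sym; irrefl to T-irrefl)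
  open ≤-Reasoning

  d : Fin n → Fin n → ℕ
  d = dist T

  private
    connected : Connected T
    connected = proj₁ (proj₂ tree)

    acyclic : Acyclic T
    acyclic = proj₂ (proj₂ tree)

    d-reached : ∀ x y → reach T (d x y) x y ≡ true
    d-reached = dist-reached T connected

  edge-sym : ∀ {a b} → T a b ≡ true → T b a ≡ true
  edge-sym {a} {b} e = trans (T-sym b a) e

  edge-≢ : ∀ {a b} → T a b ≡ true → a ≢ b
  edge-≢ {a} e refl = contradiction (trans (sym e) (T-irrefl a)) λ ()

  d-< : ∀ x y → d x y < n
  d-< = dist-< T connected

  d-self : ∀ x → d x x ≡ 0
  d-self x = n≤0⇒n≡0 (dist-≤ T 0 (reach-refl T x))

  d≡0⇒≡ : ∀ {x y} → d x y ≡ 0 → x ≡ y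
  d≡0⇒≡ {x} {y} eq = reach-0⇒≡ T (subst (λ k → reach T k x y ≡ true) eq (d-reached x y))

  d-sym : ∀ x y → d x y ≡ d y x
  d-sym x y = ≤-antisym (d-sym-≤ y x) (d-sym-≤ x y)
    where
    d-sym-≤ : ∀ x y → d y x ≤ d x y
    d-sym-≤ x y = dist-≤ T (d x y) (reach-sym T T-sym (d x y) (d-reached x y))

  d-edge : ∀ {x a b} → T a b ≡ true → d x b ≤ suc (d x a)
  d-edge {x} {a} e = dist-≤ T _ (reach-step T (d x a) {x} (d-reached x a) e)

  d-adjacent : ∀ {a b} → T a b ≡ true → d a b ≡ 1
  d-adjacent {a} e = ≤-antisym (dist-≤ T 1 (reach-step T 0 {a} (reach-refl T a) e))
                               (n≢0⇒n>0 (edge-≢ e ∘ d≡0⇒≡))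

  geodesic-pred : ∀ {x c} → x ≢ c → ∃[ a ] T a c ≡ true × suc (d x a) ≡ d x c
  geodesic-pred {x} {c} x≢c with d x c in eq
  ... | zero  = contradiction (d≡0⇒≡ eq) x≢c
  ... | suc k with reach-suc⁻ T k (subst (λ m → reach T m x c ≡ true) eq (d-reached x c))
  ...   | inj₁ r = contradiction (subst (_≤ k) eq (dist-≤ T k r)) (n≮n k)
  ...   | inj₂ (a , r , e) =
    a , e , cong suc (≤-antisym (dist-≤ T k r) (≤-pred (subst (_≤ suc (d x a)) eq (d-edge e))))

  data Path : Fin n → Fin n → List (Fin n) → Set where
    end  : ∀ a → Path a a [ a ]
    step : ∀ {a x b L} → T a x ≡ true → Path x b L → Path a b (a ∷ L)

  path-∷ʳ : ∀ {a b c L} → Path a b L → T b c ≡ true → Path a c (L ∷ʳ c)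
  path-∷ʳ (end _)    e = step e (end _)
  path-∷ʳ (step e p) e′ = step e (path-∷ʳ p e′)

  path-length : ∀ {a b L} → Path a b L → a ≢ b → 2 ≤ length L
  path-length (end _)             a≢b = contradiction refl a≢b
  path-length (step _ (end _))    _   = s≤s (s≤s z≤n)
  path-length (step _ (step _ _)) _   = s≤s (s≤s z≤n)

  path-adjacent : ∀ {a b y c L} → Path a b L → T y a ≡ true → T b c ≡ true →
                  ConsecAdj T (y ∷ L ∷ʳ c)
  path-adjacent (end _)    eya ebc = eya , ebc , tt
  path-adjacent (step e p) eya ebc = eya , path-adjacent p e ebc

  d≡suc⇒≢ : ∀ {x y k} → d x y ≡ suc k → x ≢ y
  d≡suc⇒≢ {x} eq refl = 0≢1+n (trans (sym (d-self x)) eq)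

  below-∉ : ∀ {z j x L} → d z x ≡ j → All (λ y → suc j ≤ d z y) L → All (x ≢_) L
  below-∉ dx L> = All.map (λ { le refl → <-irrefl (sym dx) le }) L>

  -- Descending from both ends along geodesics to z either closes a cycle
  -- or yields such a path one level lower.
  no-level-path : ∀ z k {a b L} → Path a b L → a ≢ b → d z a ≡ k → d z b ≡ k →
                  All (λ x → k ≤ d z x) L → Unique L → ⊥
  no-level-path z zero p a≢b da db _ _ = a≢b (trans (sym (d≡0⇒≡ da)) (d≡0⇒≡ db))
  no-level-path z (suc j) {a} {b} {L} p a≢b da db L≥ L!
    with a′ , ea , da′ ← geodesic-pred {z} {a} (d≡suc⇒≢ da)
       | b′ , eb , db′ ← geodesic-pred {z} {b} (d≡suc⇒≢ db)
    with a′ ≟ b′ | suc-injective (trans da′ da) | suc-injective (trans db′ db)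
  ... | yes refl | a′-level | _ =
    acyclic (a′ ∷ L) ( s≤s (path-length p a≢b)
                     , below-∉ a′-level L≥ ∷ L!
                     , path-adjacent p ea (edge-sym eb))
  ... | no a′≢b′ | a′-level | b′-level =
    no-level-path z j (step ea (path-∷ʳ p (edge-sym eb))) a′≢b′ a′-level b′-level
      (≤-reflexive (sym a′-level)
        ∷ ∷ʳ⁺ (All.map (≤-trans (n≤1+n j)) L≥) (≤-reflexive (sym b′-level)))
      (∷ʳ⁺ (below-∉ a′-level L≥) a′≢b′
        ∷ Unique-∷ʳ L! (All.map ≢-sym (below-∉ b′-level L≥)))

  edge-d-≢ : ∀ {x a b} → T a b ≡ true → d x a ≢ d x b
  edge-d-≢ {x} {a} {b} e eq =
    no-level-path x (d x a) (step e (end b)) (edge-≢ e) refl (sym eq)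
      (≤-refl ∷ ≤-reflexive eq ∷ []) ((edge-≢ e ∷ []) ∷ [] ∷ [])

  d-edge-cases : ∀ {x a b} → T a b ≡ true → d x b ≡ suc (d x a) ⊎ d x a ≡ suc (d x b)
  d-edge-cases {x} {a} {b} e with <-cmp (d x a) (d x b)
  ... | tri< a<b _ _ = inj₁ (≤-antisym (d-edge e) a<b)
  ... | tri≈ _ a≡b _ = contradiction a≡b (edge-d-≢ e)
  ... | tri> _ _ b<a = inj₂ (≤-antisym (d-edge (edge-sym e)) b<a)

  d-edgeˡ : ∀ {y a b} → T a b ≡ true → d b y ≤ suc (d a y)
  d-edgeˡ {y} {a} {b} e = subst₂ (λ p q → p ≤ suc q) (d-sym y b) (d-sym y a) (d-edge e)

  closer-neighbours-≡ : ∀ {x c a b} → T c a ≡ true → T c b ≡ true →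
                        d x a < d x c → d x b < d x c → a ≡ b
  closer-neighbours-≡ {x} {c} {a} {b} eca ecb a< b< with a ≟ b
  ... | yes a≡b = a≡b
  ... | no  a≢b = ⊥-elim (no-level-path x (d x a) (step (edge-sym eca) (step ecb (end b)))
                    a≢b refl (sym da≡db) (≤-refl ∷ <⇒≤ a< ∷ ≤-reflexive da≡db ∷ [])
                    ( ((<⇒≢ a< ∘ cong (d x)) ∷ a≢b ∷ [])
                    ∷ ((<⇒≢ b< ∘ cong (d x) ∘ sym) ∷ [])
                    ∷ [] ∷ []))
    where
    da≡db : d x a ≡ d x b
    da≡db = suc-injective (trans (sym (≤-antisym (d-edge (edge-sym eca)) a<))
                                 (≤-antisym (d-edge (edge-sym ecb)) b<))

  d-toward : ∀ {x v a} → T v a ≡ true → d x a < d x v → d x v ≡ suc (d x a)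
  d-toward e a< = ≤-antisym (d-edge (edge-sym e)) a<

  d-away : ∀ {x v a} → T v a ≡ true → ¬ d x a < d x v → d x a ≡ suc (d x v)
  d-away e a≮ = ≤-antisym (d-edge e) (≤∧≢⇒< (≮⇒≥ a≮) (edge-d-≢ e))

  d-other-neighbour : ∀ {x v a b} → T v a ≡ true → T v b ≡ true → a ≢ b →
                      d x a < d x v → d x b ≡ suc (d x v)
  d-other-neighbour ea eb a≢b a< = d-away eb (a≢b ∘ closer-neighbours-≡ ea eb a<)

  toward-along-edge : ∀ {a b v m} → T a b ≡ true → b ≢ v → T v m ≡ true →
                      d a m < d a v → d b m < d b v
  toward-along-edge {a} {b} {v} {m} e b≢v em m< with d-edge-cases {v} e
  ... | inj₁ b-farther = begin-strict
    d b m        ≤⟨ d-edgeˡ e ⟩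
    suc (d a m)  ≤⟨ m< ⟩
    d a v        ≡⟨ d-sym a v ⟩
    d v a        <⟨ n<1+n (d v a) ⟩
    suc (d v a)  ≡⟨ trans (sym b-farther) (d-sym v b) ⟩
    d b v        ∎
  ... | inj₂ a-farther with m′ , em′ , dm′ ← geodesic-pred b≢v
    with refl ← closer-neighbours-≡ em (edge-sym em′) m< (begin-strict
                  d a m′        ≤⟨ d-edgeˡ (edge-sym e) ⟩
                  suc (d b m′)  ≡⟨ dm′ ⟩
                  d b v         <⟨ n<1+n (d b v) ⟩
                  suc (d b v)   ≡⟨ trans (cong suc (d-sym b v)) (trans (sym a-farther) (d-sym v a)) ⟩
                  d a v         ∎)
    = ≤-reflexive dm′

  toward-⇔ : ∀ {a b v m} → T a b ≡ true → a ≢ v → b ≢ v → T v m ≡ true →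
             (d a m < d a v) ⇔ (d b m < d b v)
  toward-⇔ e a≢v b≢v em =
    mk⇔ (toward-along-edge e b≢v em) (toward-along-edge (edge-sym e) a≢v em)

data Part : Set where
  atV inP inQ inM : Part

part : Bool → Bool → Bool → Part
part true  _     _     = atV
part false true  _     = inP
part false false true  = inQ
part false false false = inM

part-cong : ∀ {a a′ b b′ c c′} → a ≡ a′ → b ≡ b′ → c ≡ c′ → part a b c ≡ part a′ b′ c′
part-cong refl refl refl = refl

swapPQ : Part → Part
swapPQ inP = inQ
swapPQ inQ = inP
swapPQ c   = c

part-swap : {A B C : Set} (a : Dec A) (b : Dec B) (c : Dec C) → ¬ (B × C) →
            part (does a) (does c) (does b) ≡ swapPQ (part (does a) (does b) (does c))
part-swap (yes _) _       _       _   = refl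
part-swap (no _)  (yes b) (yes c) ¬bc = contradiction (b , c) ¬bc
part-swap (no _)  (yes _) (no _)  _   = refl
part-swap (no _)  (no _)  (yes _) _   = refl
part-swap (no _)  (no _)  (no _)  _   = refl

-- Moving M from v to its neighbour in P changes the distance between a vertex
-- of part c and one of part c′ by shift c c′ - shift c c.
shift : Part → Part → ℕ
shift inM inP = 0
shift inM inM = 1
shift inM _   = 2
shift inP inM = 0
shift inP _   = 1
shift _   inM = 1
shift _   _   = 0

shift-bound : ∀ c c′ → shift c c′ ≤ suc (shift c c)
shift-bound atV atV = ≤ᵇ⇒≤ _ _ _
shift-bound atV inP = ≤ᵇ⇒≤ _ _ _
shift-bound atV inQ = ≤ᵇ⇒≤ _ _ _
shift-bound atV inM = ≤ᵇ⇒≤ _ _ _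
shift-bound inP atV = ≤ᵇ⇒≤ _ _ _
shift-bound inP inP = ≤ᵇ⇒≤ _ _ _
shift-bound inP inQ = ≤ᵇ⇒≤ _ _ _
shift-bound inP inM = ≤ᵇ⇒≤ _ _ _
shift-bound inQ atV = ≤ᵇ⇒≤ _ _ _
shift-bound inQ inP = ≤ᵇ⇒≤ _ _ _
shift-bound inQ inQ = ≤ᵇ⇒≤ _ _ _
shift-bound inQ inM = ≤ᵇ⇒≤ _ _ _
shift-bound inM atV = ≤ᵇ⇒≤ _ _ _
shift-bound inM inP = ≤ᵇ⇒≤ _ _ _
shift-bound inM inQ = ≤ᵇ⇒≤ _ _ _
shift-bound inM inM = ≤ᵇ⇒≤ _ _ _

-- Summing both moves (P and Q exchange roles), the change is balance c c′ - balance c c.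
balance : Part → Part → ℕ
balance c c′ = shift c c′ + shift (swapPQ c) (swapPQ c′)

balance-min : ∀ c c′ → balance c c ≤ balance c c′
balance-min atV atV = ≤ᵇ⇒≤ _ _ _
balance-min atV inP = ≤ᵇ⇒≤ _ _ _
balance-min atV inQ = ≤ᵇ⇒≤ _ _ _
balance-min atV inM = ≤ᵇ⇒≤ _ _ _
balance-min inP atV = ≤ᵇ⇒≤ _ _ _
balance-min inP inP = ≤ᵇ⇒≤ _ _ _
balance-min inP inQ = ≤ᵇ⇒≤ _ _ _
balance-min inP inM = ≤ᵇ⇒≤ _ _ _
balance-min inQ atV = ≤ᵇ⇒≤ _ _ _
balance-min inQ inP = ≤ᵇ⇒≤ _ _ _
balance-min inQ inQ = ≤ᵇ⇒≤ _ _ _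
balance-min inQ inM = ≤ᵇ⇒≤ _ _ _
balance-min inM atV = ≤ᵇ⇒≤ _ _ _
balance-min inM inP = ≤ᵇ⇒≤ _ _ _
balance-min inM inQ = ≤ᵇ⇒≤ _ _ _
balance-min inM inM = ≤ᵇ⇒≤ _ _ _

Near : ℕ → ℕ → Set
Near p q = p ≤ suc q × q ≤ suc p

near-sym : ∀ {p q} → Near p q → Near q p
near-sym (p≤ , q≤) = q≤ , p≤

near-suc : ∀ k → Near (suc k) k
near-suc k = ≤-refl , m≤n⇒m≤1+n (n≤1+n k)

near-+ : ∀ k {p q} → Near p q → Near (k + p) (k + q)
near-+ k {p} {q} (p≤ , q≤) = bound p≤ , bound q≤
  where
  bound : ∀ {p q} → p ≤ suc q → k + p ≤ suc (k + q)
  bound {p} {q} le = subst (k + p ≤_) (+-suc k q) (+-monoʳ-≤ k le)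

Profile : Part → (dv du dw : ℕ) → Set
Profile atV dv du dw = dv ≡ 0 × du ≡ 1 × dw ≡ 1
Profile inP dv du dw = dv ≡ suc du × dw ≡ suc dv
Profile inQ dv du dw = du ≡ suc dv × dv ≡ suc dw
Profile inM dv du dw = du ≡ suc dv × dw ≡ suc dv

ProfileM : Part → (dv dm : ℕ) → Set
ProfileM atV _  dm = dm ≡ 1
ProfileM inP dv dm = dm ≡ suc dv
ProfileM inQ dv dm = dm ≡ suc dv
ProfileM inM dv dm = dm ≡ suc dv ⊎ dv ≡ suc dm

near-u-v : ∀ c {dv du dw} → Profile c dv du dw → Near (shift c inP + du) (shift c atV + dv)
near-u-v atV (refl , refl , refl) = near-suc 0
near-u-v inP (refl , refl)        = near-sym (near-suc _)
near-u-v inQ (refl , refl)        = near-suc _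
near-u-v inM (refl , refl)        = near-sym (near-suc _)

near-w-v : ∀ c {dv du dw} → Profile c dv du dw → Near (shift c inQ + dw) (shift c atV + dv)
near-w-v atV (refl , refl , refl) = near-suc 0
near-w-v inP (refl , refl)        = near-suc _
near-w-v inQ (refl , refl)        = near-sym (near-suc _)
near-w-v inM (refl , refl)        = near-suc _

near-m-u : ∀ c {dv du dw dm} → Profile c dv du dw → ProfileM c dv dm →
           Near (shift c inM + dm) (shift c inP + du)
near-m-u atV (refl , refl , refl) refl        = near-suc 1
near-m-u inP (refl , refl)        refl        = near-suc _
near-m-u inQ (refl , refl)        refl        = near-suc _
near-m-u inM (refl , refl)        (inj₁ refl) = near-suc _
near-m-u inM (refl , refl)        (inj₂ refl) = near-sym (near-suc _)

module Move {n : ℕ} (T : Graph n) (tree : IsTree T) (v u w : Fin n) (vs : List (Fin n))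
            (u≢w : u ≢ w) (u∉vs : u ∉ vs) (w∉vs : w ∉ vs)
            (nbrs : (x : Fin n) → (T v x ≡ true) ⇔ (x ≡ u ⊎ x ≡ w ⊎ x ∈ vs)) where

  open TreeDistance T tree
  open ≤-Reasoning

  v-u : T v u ≡ true
  v-u = Equivalence.from (nbrs u) (inj₁ refl)

  v-w : T v w ≡ true
  v-w = Equivalence.from (nbrs w) (inj₂ (inj₁ refl))

  v-m : ∀ {m} → m ∈ vs → T v m ≡ true
  v-m m∈vs = Equivalence.from (nbrs _) (inj₂ (inj₂ m∈vs))

  part-of : Fin n → Part
  part-of z = part (does (z ≟ v)) (does (d z u <? d z v)) (does (d z w <? d z v))

  data PartView (z : Fin n) : Part → Set where
    at-v     : z ≡ v → PartView z atV
    toward-u : z ≢ v → d z u < d z v → PartView z inP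
    toward-w : z ≢ v → ¬ d z u < d z v → d z w < d z v → PartView z inQ
    neither  : z ≢ v → ¬ d z u < d z v → ¬ d z w < d z v → PartView z inM

  partView : ∀ z → PartView z (part-of z)
  partView z = view (z ≟ v) (d z u <? d z v) (d z w <? d z v)
    where
    view : (a : Dec (z ≡ v)) (b : Dec (d z u < d z v)) (c : Dec (d z w < d z v)) →
           PartView z (part (does a) (does b) (does c))
    view (yes z≡v) _      _      = at-v z≡v
    view (no z≢v)  (yes b) _     = toward-u z≢v b
    view (no z≢v)  (no ¬b) (yes c) = toward-w z≢v ¬b c
    view (no z≢v)  (no ¬b) (no ¬c) = neither z≢v ¬b ¬c

  self-closer : ∀ {y} → T v y ≡ true → d y y < d y v
  self-closer {y} e = subst₂ _<_ (sym (d-self y)) (sym (d-adjacent (edge-sym e))) (s≤s z≤n)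

  only-closer : ∀ {y z} → T v y ≡ true → T v z ≡ true → d z y < d z v → z ≡ y
  only-closer ey ez y< = closer-neighbours-≡ ez ey (self-closer ez) y<

  part-v : part-of v ≡ atV
  part-v = part-cong (dec-true (v ≟ v) refl) refl refl

  part-u : part-of u ≡ inP
  part-u with part-of u | partView u
  ... | _ | at-v u≡v       = contradiction (sym u≡v) (edge-≢ v-u)
  ... | _ | toward-u _ _   = refl
  ... | _ | toward-w _ u≮ _ = contradiction (self-closer v-u) u≮
  ... | _ | neither _ u≮ _  = contradiction (self-closer v-u) u≮

  part-w : part-of w ≡ inQ
  part-w with part-of w | partView w
  ... | _ | at-v w≡v         = contradiction (sym w≡v) (edge-≢ v-w)
  ... | _ | toward-u _ u<    = contradiction (sym (only-closer v-u v-w u<)) u≢w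
  ... | _ | toward-w _ _ _   = refl
  ... | _ | neither _ _ w≮   = contradiction (self-closer v-w) w≮

  part-m : ∀ {m} → m ∈ vs → part-of m ≡ inM
  part-m {m} m∈vs with part-of m | partView m
  ... | _ | at-v m≡v       = contradiction (sym m≡v) (edge-≢ (v-m m∈vs))
  ... | _ | toward-u _ u<   = contradiction (subst (_∈ vs) (only-closer v-u (v-m m∈vs) u<) m∈vs) u∉vs
  ... | _ | toward-w _ _ w< = contradiction (subst (_∈ vs) (only-closer v-w (v-m m∈vs) w<) m∈vs) w∉vs
  ... | _ | neither _ _ _  = refl

  profile : ∀ x → Profile (part-of x) (d x v) (d x u) (d x w)
  profile x with part-of x | partView x
  ... | _ | at-v refl         = d-self v , d-adjacent v-u , d-adjacent v-w
  ... | _ | toward-u _ u<     = d-toward v-u u< , d-other-neighbour v-u v-w u≢w u<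
  ... | _ | toward-w _ u≮ w<  = d-away v-u u≮ , d-toward v-w w<
  ... | _ | neither _ u≮ w≮   = d-away v-u u≮ , d-away v-w w≮

  profileM : ∀ x {m} → m ∈ vs → ProfileM (part-of x) (d x v) (d x m)
  profileM x {m} m∈vs with part-of x | partView x
  ... | _ | at-v refl      = d-adjacent (v-m m∈vs)
  ... | _ | toward-u _ u<   = d-other-neighbour v-u (v-m m∈vs) (λ { refl → u∉vs m∈vs }) u<
  ... | _ | toward-w _ _ w< = d-other-neighbour v-w (v-m m∈vs) (λ { refl → w∉vs m∈vs }) w<
  ... | _ | neither _ _ _  = d-edge-cases (v-m m∈vs)

  part-edge : ∀ {a b} → T a b ≡ true → a ≢ v → b ≢ v → part-of a ≡ part-of b
  part-edge {a} {b} e a≢v b≢v = part-cong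
    (trans (dec-false (a ≟ v) a≢v) (sym (dec-false (b ≟ v) b≢v)))
    (does-⇔ (toward-⇔ e a≢v b≢v v-u) (d a u <? d a v) (d b u <? d b v))
    (does-⇔ (toward-⇔ e a≢v b≢v v-w) (d a w <? d a v) (d b w <? d b v))

  T′ : Graph n
  T′ = moveTo T v u vs

  ψ : Fin n → Fin n → ℕ
  ψ x z = shift (part-of x) (part-of z) + d x z

  near-at-parts : ∀ x {y z c c′} → part-of y ≡ c → part-of z ≡ c′ →
                  Near (shift (part-of x) c + d x y) (shift (part-of x) c′ + d x z) →
                  Near (ψ x y) (ψ x z)
  near-at-parts x refl refl near = near

  ψ-near-u-v : ∀ x → Near (ψ x u) (ψ x v)
  ψ-near-u-v x = near-at-parts x part-u part-v (near-u-v (part-of x) (profile x))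

  ψ-near-w-v : ∀ x → Near (ψ x w) (ψ x v)
  ψ-near-w-v x = near-at-parts x part-w part-v (near-w-v (part-of x) (profile x))

  ψ-near-m-u : ∀ x {m} → m ∈ vs → Near (ψ x m) (ψ x u)
  ψ-near-m-u x m∈vs =
    near-at-parts x (part-m m∈vs) part-u (near-m-u (part-of x) (profile x) (profileM x m∈vs))

  ψ-near-v : ∀ x {y} → T v y ≡ true → y ∉ vs → Near (ψ x v) (ψ x y)
  ψ-near-v x {y} e y∉vs with Equivalence.to (nbrs y) e
  ... | inj₁ refl         = near-sym (ψ-near-u-v x)
  ... | inj₂ (inj₁ refl)  = near-sym (ψ-near-w-v x)
  ... | inj₂ (inj₂ y∈vs) = contradiction y∈vs y∉vs

  ψ-near-kept : ∀ x {a b} → Dec (a ≡ v) → Dec (b ≡ v) → T a b ≡ true →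
                ¬ (a ≡ v × b ∈ vs ⊎ b ≡ v × a ∈ vs) → Near (ψ x a) (ψ x b)
  ψ-near-kept x (yes refl) _          e not-moved =
    ψ-near-v x e (λ b∈vs → not-moved (inj₁ (refl , b∈vs)))
  ψ-near-kept x (no _)     (yes refl) e not-moved =
    near-sym (ψ-near-v x (edge-sym e) (λ a∈vs → not-moved (inj₂ (refl , a∈vs))))
  ψ-near-kept x {a} {b} (no a≢v) (no b≢v) e _ =
    subst (λ c → Near (ψ x a) (shift (part-of x) c + d x b)) (part-edge e a≢v b≢v)
          (near-+ (shift (part-of x) (part-of a)) (d-edge (edge-sym e) , d-edge e))

  ψ-near : ∀ x {a b} → T′ a b ≡ true → Near (ψ x a) (ψ x b)
  ψ-near x {a} {b} e with moveTo-edge T v u vs {a} {b} e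
  ... | _         , inj₁ (inj₁ (refl , b∈vs)) = near-sym (ψ-near-m-u x b∈vs)
  ... | _         , inj₁ (inj₂ (refl , a∈vs)) = ψ-near-m-u x a∈vs
  ... | not-moved , inj₂ e′                   = ψ-near-kept x (a ≟ v) (b ≟ v) e′ not-moved

  ψ-self : ∀ x → ψ x x ≡ shift (part-of x) (part-of x)
  ψ-self x = trans (cong (shift (part-of x) (part-of x) +_) (d-self x)) (+-identityʳ _)

  ψ-≤-n : ∀ x y → ψ x y ≤ n + ψ x x
  ψ-≤-n x y = begin
    ψ x y            ≤⟨ +-monoˡ-≤ (d x y) (shift-bound (part-of x) (part-of y)) ⟩
    suc s + d x y    ≡⟨ +-suc s (d x y) ⟨
    s + suc (d x y)  ≤⟨ +-monoʳ-≤ s (d-< x y) ⟩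
    s + n            ≡⟨ +-comm s n ⟩
    n + s            ≡⟨ cong (n +_) (ψ-self x) ⟨
    n + ψ x x        ∎
    where
    s : ℕ
    s = shift (part-of x) (part-of x)

  dist-moved-≥ : ∀ x y → shift (part-of x) (part-of y) + d x y ≤
                         dist T′ x y + shift (part-of x) (part-of x)
  dist-moved-≥ x y = subst (λ k → ψ x y ≤ dist T′ x y + k) (ψ-self x)
    (dist-potential T′ (ψ x) (proj₂ ∘ ψ-near x) x y (ψ-≤-n x y))

module BothMoves {n : ℕ} (T : Graph n) (tree : IsTree T) (v u w : Fin n) (vs : List (Fin n))
                 (u≢w : u ≢ w) (u∉vs : u ∉ vs) (w∉vs : w ∉ vs)
                 (nbrs : (x : Fin n) → (T v x ≡ true) ⇔ (x ≡ u ⊎ x ≡ w ⊎ x ∈ vs)) where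

  open TreeDistance T tree
  open ≤-Reasoning

  Tu Tw : Graph n
  Tu = moveTo T v u vs
  Tw = moveTo T v w vs

  private
    swap₁₂ : {A B C : Set} → A ⊎ B ⊎ C → B ⊎ A ⊎ C
    swap₁₂ = assocʳ ∘ Sum.map₁ Sum.swap ∘ assocˡ

    module ToU = Move T tree v u w vs u≢w u∉vs w∉vs nbrs
    module ToW = Move T tree v w u vs (≢-sym u≢w) w∉vs u∉vs
      (λ x → mk⇔ (swap₁₂ ∘ Equivalence.to (nbrs x)) (Equivalence.from (nbrs x) ∘ swap₁₂))

  open ToU using (part-of; part-v; part-m; v-u; v-w; v-m)

  part-swapped : ∀ z → ToW.part-of z ≡ swapPQ (part-of z)
  part-swapped z = part-swap (z ≟ v) (d z u <? d z v) (d z w <? d z v)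
                     λ (u< , w<) → u≢w (closer-neighbours-≡ v-u v-w u< w<)

  dist-sum-≥ : ∀ x y → balance (part-of x) (part-of y) + (d x y + d x y) ≤
                       (dist Tu x y + dist Tw x y) + balance (part-of x) (part-of x)
  dist-sum-≥ x y = begin
    (shift c c′ + shift (swapPQ c) (swapPQ c′)) + (d x y + d x y)
      ≡⟨ interchange (shift c c′) _ (d x y) (d x y) ⟩
    (shift c c′ + d x y) + (shift (swapPQ c) (swapPQ c′) + d x y)
      ≤⟨ +-mono-≤ (ToU.dist-moved-≥ x y)
                  (subst₂ (λ c c′ → shift c c′ + d x y ≤ dist Tw x y + shift c c)
                          (part-swapped x) (part-swapped y) (ToW.dist-moved-≥ x y)) ⟩
    (dist Tu x y + shift c c) + (dist Tw x y + shift (swapPQ c) (swapPQ c))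
      ≡⟨ interchange (dist Tu x y) _ (dist Tw x y) _ ⟩
    (dist Tu x y + dist Tw x y) + balance c c ∎
    where
    c c′ : Part
    c = part-of x
    c′ = part-of y

  dist-sum-gain : ∀ s x y → s + balance (part-of x) (part-of x) ≤ balance (part-of x) (part-of y) →
                  s + (d x y + d x y) ≤ dist Tu x y + dist Tw x y
  dist-sum-gain s x y = +-cancel-slack s (dist-sum-≥ x y)

  wiener-sum-< : ∀ {m} → m ∈ vs → W T + W T < W Tu + W Tw
  wiener-sum-< {m} m∈vs = begin-strict
    W T + W T                                    ≡⟨ pairSum-+ d d ⟨
    pairSum (λ x y → d x y + d x y)              <⟨ pairSum-mono-<-pair dist-sum-≤ (edge-≢ (v-m m∈vs))
                                                                        v-m-gain m-v-gain ⟩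
    pairSum (λ x y → dist Tu x y + dist Tw x y)  ≡⟨ pairSum-+ (dist Tu) (dist Tw) ⟩
    W Tu + W Tw                                  ∎
    where
    dist-sum-≤ : ∀ x y → d x y + d x y ≤ dist Tu x y + dist Tw x y
    dist-sum-≤ x y = dist-sum-gain 0 x y (balance-min (part-of x) (part-of y))
    gains : Part → Part → Set
    gains c c′ = 1 + balance c c ≤ balance c c′
    v-m-gain : d v m + d v m < dist Tu v m + dist Tw v m
    v-m-gain = dist-sum-gain 1 v m (subst₂ gains (sym part-v) (sym (part-m m∈vs)) (≤ᵇ⇒≤ _ _ _))
    m-v-gain : d m v + d m v < dist Tu m v + dist Tw m v
    m-v-gain = dist-sum-gain 1 m v (subst₂ gains (sym (part-m m∈vs)) (sym part-v) (≤ᵇ⇒≤ _ _ _))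

  wiener-< : ∀ {m} → m ∈ vs → W T < W Tu ⊔ W Tw
  wiener-< m∈vs = m+m<n+o⇒m<n⊔o {W T} {W Tu} {W Tw} (wiener-sum-< m∈vs)

lemma3p1 : {n : ℕ} (T : Graph n) → IsTree T →
    (v u w : Fin n) (vs : List (Fin n)) →
    1 ≤ length vs → Unique vs → u ≢ w → u ∉ vs → w ∉ vs →
    ((x : Fin n) → (T v x ≡ true) ⇔ (x ≡ u ⊎ x ≡ w ⊎ x ∈ vs)) →
    W T < W (moveTo T v u vs) ⊔ W (moveTo T v w vs)
lemma3p1 T tree v u w []       ()
lemma3p1 T tree v u w (m ∷ ms) _ _ u≢w u∉vs w∉vs nbrs =
  BothMoves.wiener-< T tree v u w (m ∷ ms) u≢w u∉vs w∉vs nbrs (here refl)
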